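{- Let $p\in\mathcal P$ and let $m$ be a positive integer coprime to $p$ such that $pm\equiv 1\pmod{24}$. Let $j\in\{1,4,8\}$ be such that $x^2+216y^2=jp$ has a solution $(x,y)\in\mathbb Z^2$ with $\gcd(x,y)=1$. Define $$X_{p,m}=\{(x,y)\in\mathbb Z^2: x^2+216y^2=pm,\ \gcd(x,y)=1\},\qquad A_m=\{(a,b)\in\mathbb Z^2: a^2+216b^2=jm,\ \gcd(a,b)=1\}.$$ Then $|X_{p,m}|=2|A_m|$.
   Context: A solution $(x,y)\in\mathbb Z^2$ of a Diophantine equation is called primitive if $\gcd(x,y)=1$. $\mathcal P$ denotes the set of primes $p$ such that for some $j\in\{1,4,8\}$ the equation $x^2+216y^2=jp$ has a primitive solution. -}

module Defs where

open import Data.Nat as ℕ using (ℕ)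
open import Data.Nat.Primality using (Prime)
open import Data.Integer using (ℤ; +_; _+_; _*_; 1ℤ)
open import Data.Integer.GCD using (gcd)
open import Data.Fin using (Fin)
open import Data.Product using (Σ; ∃; _×_; _,_)
open import Data.Sum using (_⊎_)
open import Function.Bundles using (_↔_)
open import Relation.Binary.PropositionalEquality using (_≡_)

IsPrimSol : ℕ → ℤ × ℤ → Set
IsPrimSol N (x , y) = (x * x + + 216 * (y * y) ≡ + N) × (gcd x y ≡ 1ℤ)

PrimSols : ℕ → Set
PrimSols N = Σ (ℤ × ℤ) (IsPrimSol N)

J : ℕ → Set
J j = (j ≡ 1) ⊎ (j ≡ 4) ⊎ (j ≡ 8)

InP : ℕ → Set
InP p = Prime p × (∃ λ j → J j × PrimSols (j ℕ.* p))

X : ℕ → ℕ → Set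
X p m = PrimSols (p ℕ.* m)

A : ℕ → ℕ → Set
A j m = PrimSols (j ℕ.* m)

HasCard : Set → ℕ → Set
HasCard S n = S ↔ Fin n

module Submission where

-- Fix a primitive representation w = (u , v) of j p and compose with it:
-- (x , y) ∘ w = (x u + 216 y v , x v − y u), so that N(z ∘ w) = N(z) N(w) and (z ∘ w) ∘ w = N(w) · z.
-- For a primitive representation z of p m, exactly one of z and its conjugate (x , − y) has z ∘ w ≡ 0 (mod p),
-- which splits X_{p,m} into two copies of the set of such z. On that set z ↦ (z ∘ w) / p is a bijection onto
-- the primitive representations q of j m with q ∘ w ≡ 0 (mod j), with inverse q ↦ (q ∘ w) / j.
-- The last condition holds for every q ∈ A_m: for j = 4 by parity, and for j = 8 because p m ≡ 1 (mod 8).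

open import Defs
open import Data.Nat as ℕ using (ℕ; zero; suc; _≤_; _<_; z≤n; s≤s; NonZero; _%_; _>_)
import Data.Nat.Properties as ℕ
import Data.Nat.Divisibility as ℕ
import Data.Nat.GCD as ℕ
import Data.Nat.Coprimality as ℕ
open import Data.Nat.Base using (nonTrivial⇒≢1)
open import Data.Nat.Primality using (Prime; euclidsLemma; prime⇒nonZero; prime⇒nonTrivial; prime⇒irreducible)
open import Data.Integer as ℤ using (ℤ; +_; -[1+_]; ∣_∣; _+_; _*_; _-_; -_; 1ℤ)
import Data.Integer.Properties as ℤ
open import Data.Integer.GCD using (gcd)
open import Data.Integer.Coprimality using (Coprime)
open import Data.Integer.Divisibility.Signed
open import Data.Integer.DivMod using (_%ℕ_; _/ℕ_; n%ℕd<d; a≡a%ℕn+[a/ℕn]*n)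
open import Data.Integer.Tactic.RingSolver using (solve-∀)
open import Data.Fin using (Fin; zero)
open import Data.Fin.Properties using (+↔⊎)
open import Data.Product using (Σ; ∃; _×_; _,_; proj₁; proj₂)
open import Data.Product.Algebra using (Σ-assoc-alt)
open import Data.Sum as Sum using (_⊎_; inj₁; inj₂; [_,_]′)
open import Data.Sum.Function.Propositional using (_⊎-↔_)
open import Data.Empty using (⊥; ⊥-elim)
open import Function.Base using (id; _∘_)
open import Function.Bundles using (_↔_; mk↔ₛ′)
open import Function.Properties.Inverse using (↔-trans; ↔-sym)
open import Relation.Binary.PropositionalEquality hiding (J)
open import Relation.Nullary using (¬_; Dec; yes; no; Irrelevant)
open import Relation.Nullary.Decidable using (_×-dec_; from-no)
open import Axiom.UniquenessOfIdentityProofs using (module Decidable⇒UIP)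

-- Finite types

Finite : Set → Set
Finite S = ∃ λ n → S ↔ Fin n

Finite-resp-↔ : ∀ {S T} → S ↔ T → Finite T → Finite S
Finite-resp-↔ S↔T (n , T↔n) = n , ↔-trans S↔T T↔n

empty-finite : ∀ {S} → ¬ S → Finite S
empty-finite ¬s = 0 , mk↔ₛ′ (λ s → ⊥-elim (¬s s)) (λ ()) (λ ()) (λ s → ⊥-elim (¬s s))

dec-irrelevant-finite : ∀ {Q} → Dec Q → Irrelevant Q → Finite Q
dec-irrelevant-finite (no ¬q) _ = empty-finite ¬q
dec-irrelevant-finite (yes q) irr = 1 , mk↔ₛ′ (λ _ → zero) (λ _ → q) (λ { zero → refl }) (irr q)

⊎-finite : ∀ {S T} → Finite S → Finite T → Finite (S ⊎ T)
⊎-finite (n , S↔n) (k , T↔k) = n ℕ.+ k , ↔-trans (S↔n ⊎-↔ T↔k) (↔-sym (+↔⊎ {n} {k}))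

Σℕ-↔-zero⊎suc : (T : ℕ → Set) → Σ ℕ T ↔ (T zero ⊎ Σ ℕ (λ n → T (suc n)))
Σℕ-↔-zero⊎suc T = mk↔ₛ′ split join split∘join join∘split
  where
  split : Σ ℕ T → T zero ⊎ Σ ℕ (λ n → T (suc n))
  split (zero , t) = inj₁ t
  split (suc n , t) = inj₂ (n , t)
  join : T zero ⊎ Σ ℕ (λ n → T (suc n)) → Σ ℕ T
  join (inj₁ t) = zero , t
  join (inj₂ (n , t)) = suc n , t
  split∘join : ∀ s → split (join s) ≡ s
  split∘join (inj₁ _) = refl
  split∘join (inj₂ _) = refl
  join∘split : ∀ s → join (split s) ≡ s
  join∘split (zero , _) = refl
  join∘split (suc _ , _) = refl

Σℤ-↔-+⊎-[1+] : (T : ℤ → Set) → Σ ℤ T ↔ (Σ ℕ (λ n → T (+ n)) ⊎ Σ ℕ (λ n → T -[1+ n ]))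
Σℤ-↔-+⊎-[1+] T = mk↔ₛ′ split join split∘join join∘split
  where
  split : Σ ℤ T → Σ ℕ (λ n → T (+ n)) ⊎ Σ ℕ (λ n → T -[1+ n ])
  split (+ n , t) = inj₁ (n , t)
  split (-[1+ n ] , t) = inj₂ (n , t)
  join : Σ ℕ (λ n → T (+ n)) ⊎ Σ ℕ (λ n → T -[1+ n ]) → Σ ℤ T
  join (inj₁ (n , t)) = + n , t
  join (inj₂ (n , t)) = -[1+ n ] , t
  split∘join : ∀ s → split (join s) ≡ s
  split∘join (inj₁ _) = refl
  split∘join (inj₂ _) = refl
  join∘split : ∀ s → join (split s) ≡ s
  join∘split (+ _ , _) = refl
  join∘split (-[1+ _ ] , _) = refl

Σℕ-bounded-finite : ∀ K (T : ℕ → Set) → (∀ n → T n → n < K) → (∀ n → Finite (T n)) → Finite (Σ ℕ T)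
Σℕ-bounded-finite zero T bound _ = empty-finite (λ { (n , t) → ℕ.n≮0 (bound n t) })
Σℕ-bounded-finite (suc K) T bound fin = Finite-resp-↔ (Σℕ-↔-zero⊎suc T)
  (⊎-finite (fin zero) (Σℕ-bounded-finite K (λ n → T (suc n)) (λ n t → ℕ.≤-pred (bound (suc n) t)) (λ n → fin (suc n))))

Σℤ-bounded-finite : ∀ K (T : ℤ → Set) → (∀ z → T z → ∣ z ∣ ≤ K) → (∀ z → Finite (T z)) → Finite (Σ ℤ T)
Σℤ-bounded-finite K T bound fin = Finite-resp-↔ (Σℤ-↔-+⊎-[1+] T)
  (⊎-finite (Σℕ-bounded-finite (suc K) _ (λ n t → s≤s (bound (+ n) t)) (λ n → fin (+ n)))
            (Σℕ-bounded-finite (suc K) _ (λ n t → ℕ.m≤n⇒m≤1+n (bound -[1+ n ] t)) (λ n → fin -[1+ n ])))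

-- Divisibility of integers and of pairs of integers

ℤ-≡-irrelevant : ∀ {a b : ℤ} → Irrelevant (a ≡ b)
ℤ-≡-irrelevant = Decidable⇒UIP.≡-irrelevant ℤ._≟_

∣-irrelevant : ∀ {d z} .{{_ : ℤ.NonZero d}} → Irrelevant (d ∣ z)
∣-irrelevant {d} (divides q eq) (divides q′ eq′) with ℤ.*-cancelʳ-≡ q q′ d (trans (sym eq) eq′)
... | refl = cong (divides q) (ℤ-≡-irrelevant eq eq′)

gcd≡1⇒coprime : ∀ {x y} → gcd x y ≡ 1ℤ → Coprime x y
gcd≡1⇒coprime = ℕ.gcd≡1⇒coprime ∘ ℤ.+-injective

coprime⇒gcd≡1 : ∀ {x y} → Coprime x y → gcd x y ≡ 1ℤ
coprime⇒gcd≡1 = cong +_ ∘ ℕ.coprime⇒gcd≡1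

prime-∣-* : ∀ {p} → Prime p → ∀ a b → + p ∣ a * b → (+ p ∣ a) ⊎ (+ p ∣ b)
prime-∣-* pr a b p∣ab =
  Sum.map ∣ᵤ⇒∣ ∣ᵤ⇒∣ (euclidsLemma ∣ a ∣ ∣ b ∣ pr (subst (_ ℕ.∣_) (ℤ.abs-* a b) (∣⇒∣ᵤ p∣ab)))

prime-∣-square : ∀ {p} → Prime p → ∀ a → + p ∣ a * a → + p ∣ a
prime-∣-square pr a p∣aa = [ id , id ]′ (prime-∣-* pr a a p∣aa)

Primitive : ℤ × ℤ → Set
Primitive (x , y) = gcd x y ≡ 1ℤ

infixr 7 _·²_
infix 4 _∣²_

_·²_ : ℤ → ℤ × ℤ → ℤ × ℤ
k ·² (x , y) = k * x , k * y

_∣²_ : ℤ → ℤ × ℤ → Set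
d ∣² (x , y) = (d ∣ x) × (d ∣ y)

∣²-irrelevant : ∀ {d} z .{{_ : ℤ.NonZero d}} → Irrelevant (d ∣² z)
∣²-irrelevant _ (a , b) (a′ , b′) = cong₂ _,_ (∣-irrelevant a a′) (∣-irrelevant b b′)

∣²⇒∃·² : ∀ {d} z → d ∣² z → ∃ λ q → z ≡ d ·² q
∣²⇒∃·² {d} _ (divides a refl , divides b refl) = (a , b) , cong₂ _,_ (ℤ.*-comm a d) (ℤ.*-comm b d)

·²⇒∣² : ∀ d q → d ∣² d ·² q
·²⇒∣² d (a , b) = ∣m⇒∣m*n a ∣-refl , ∣m⇒∣m*n b ∣-refl

·²-cancel : ∀ d {z z′} .{{_ : ℤ.NonZero d}} → d ·² z ≡ d ·² z′ → z ≡ z′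
·²-cancel d {x , y} {x′ , y′} eq =
  cong₂ _,_ (ℤ.*-cancelˡ-≡ d x x′ (cong proj₁ eq)) (ℤ.*-cancelˡ-≡ d y y′ (cong proj₂ eq))

·²-assoc : ∀ k l z → k ·² l ·² z ≡ (k * l) ·² z
·²-assoc k l (x , y) = cong₂ _,_ (sym (ℤ.*-assoc k l x)) (sym (ℤ.*-assoc k l y))

∣²-·²-primitive⇒∣ : ∀ {d k} z → Primitive z → d ∣² k ·² z → d ∣ k
∣²-·²-primitive⇒∣ {d} {k} (x , y) prim (d∣kx , d∣ky) = ∣ᵤ⇒∣ (subst (∣ d ∣ ℕ.∣_) ∣k∣*gcd≡∣k∣ d∣gcd)
  where
  d∣gcd : ∣ d ∣ ℕ.∣ ℕ.gcd (∣ k ∣ ℕ.* ∣ x ∣) (∣ k ∣ ℕ.* ∣ y ∣)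
  d∣gcd = ℕ.gcd-greatest (subst (∣ d ∣ ℕ.∣_) (ℤ.abs-* k x) (∣⇒∣ᵤ d∣kx))
                         (subst (∣ d ∣ ℕ.∣_) (ℤ.abs-* k y) (∣⇒∣ᵤ d∣ky))
  ∣k∣*gcd≡∣k∣ : ℕ.gcd (∣ k ∣ ℕ.* ∣ x ∣) (∣ k ∣ ℕ.* ∣ y ∣) ≡ ∣ k ∣
  ∣k∣*gcd≡∣k∣ = begin
    ℕ.gcd (∣ k ∣ ℕ.* ∣ x ∣) (∣ k ∣ ℕ.* ∣ y ∣) ≡⟨ ℕ.c*gcd[m,n]≡gcd[cm,cn] (∣ k ∣) (∣ x ∣) (∣ y ∣) ⟨
    ∣ k ∣ ℕ.* ℕ.gcd ∣ x ∣ ∣ y ∣              ≡⟨ cong (∣ k ∣ ℕ.*_) (ℤ.+-injective prim) ⟩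
    ∣ k ∣ ℕ.* 1                              ≡⟨ ℕ.*-identityʳ ∣ k ∣ ⟩
    ∣ k ∣                                    ∎
    where open ≡-Reasoning

Σ-≡-irrelevant : ∀ {A : Set} {B : A → Set} → (∀ a → Irrelevant (B a)) →
                 {s t : Σ A B} → proj₁ s ≡ proj₁ t → s ≡ t
Σ-≡-irrelevant irr {a , b} {.a , b′} refl = cong (a ,_) (irr a b b′)

primitive⇒∣²⇒∣∣≡1 : ∀ {g} z → Primitive z → g ∣² z → ∣ g ∣ ≡ 1
primitive⇒∣²⇒∣∣≡1 (x , y) prim (g∣x , g∣y) = gcd≡1⇒coprime {x} {y} prim (∣⇒∣ᵤ g∣x , ∣⇒∣ᵤ g∣y)

∣²⇒∣∣≡1⇒primitive : ∀ z → (∀ {g} → g ∣² z → ∣ g ∣ ≡ 1) → Primitive z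
∣²⇒∣∣≡1⇒primitive (x , y) h =
  coprime⇒gcd≡1 {x} {y} (λ {i} (i∣x , i∣y) → h {+ i} (∣ᵤ⇒∣ i∣x , ∣ᵤ⇒∣ i∣y))

-- The forms x² + c y² and composition

module Form (c : ℤ) where

  norm : ℤ × ℤ → ℤ
  norm (x , y) = x * x + c * (y * y)

  compose : ℤ × ℤ → ℤ × ℤ → ℤ × ℤ
  compose (x , y) (u , v) = x * u + c * (y * v) , x * v - y * u

  conj : ℤ × ℤ → ℤ × ℤ
  conj (x , y) = x , - y

  IsRep : ℕ → ℤ × ℤ → Set
  IsRep N z = norm z ≡ + N × Primitive z

  Reps : ℕ → Set
  Reps N = Σ (ℤ × ℤ) (IsRep N)

  norm-compose : ∀ z w → norm (compose z w) ≡ norm z * norm w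
  norm-compose (x , y) (u , v) = identity c x y u v
    where
    identity : ∀ c x y u v → (x * u + c * (y * v)) * (x * u + c * (y * v)) + c * ((x * v - y * u) * (x * v - y * u))
                           ≡ (x * x + c * (y * y)) * (u * u + c * (v * v))
    identity = solve-∀

  compose-compose : ∀ z w → compose (compose z w) w ≡ norm w ·² z
  compose-compose (x , y) (u , v) = cong₂ _,_ (identity₁ c x y u v) (identity₂ c x y u v)
    where
    identity₁ : ∀ c x y u v → (x * u + c * (y * v)) * u + c * ((x * v - y * u) * v) ≡ (u * u + c * (v * v)) * x
    identity₁ = solve-∀
    identity₂ : ∀ c x y u v → (x * u + c * (y * v)) * v - (x * v - y * u) * u ≡ (u * u + c * (v * v)) * y
    identity₂ = solve-∀

  compose-·²ˡ : ∀ k z w → compose (k ·² z) w ≡ k ·² compose z w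
  compose-·²ˡ k (x , y) (u , v) = cong₂ _,_ (identity₁ c k x y u v) (identity₂ k x y u v)
    where
    identity₁ : ∀ c k x y u v → k * x * u + c * (k * y * v) ≡ k * (x * u + c * (y * v))
    identity₁ = solve-∀
    identity₂ : ∀ k x y u v → k * x * v - k * y * u ≡ k * (x * v - y * u)
    identity₂ = solve-∀

  norm-·² : ∀ k z → norm (k ·² z) ≡ k * k * norm z
  norm-·² k (x , y) = identity c k x y
    where
    identity : ∀ c k x y → k * x * (k * x) + c * (k * y * (k * y)) ≡ k * k * (x * x + c * (y * y))
    identity = solve-∀

  conj-involutive : ∀ z → conj (conj z) ≡ z
  conj-involutive (x , y) = cong (x ,_) (ℤ.neg-involutive y)

  conj-isRep : ∀ {N} z → IsRep N z → IsRep N (conj z)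
  conj-isRep (x , y) (eq , prim) =
    trans (cong (λ t → x * x + c * t) (neg*neg y)) eq ,
    trans (cong (λ t → + ℕ.gcd ∣ x ∣ t) (ℤ.∣-i∣≡∣i∣ y)) prim
    where
    neg*neg : ∀ y → - y * - y ≡ y * y
    neg*neg = solve-∀

  IsRep-irrelevant : ∀ {N} z → Irrelevant (IsRep N z)
  IsRep-irrelevant _ (e , g) (e′ , g′) = cong₂ _,_ (ℤ-≡-irrelevant e e′) (ℤ-≡-irrelevant g g′)

  ∣²-compose : ∀ {d} z w → d ∣² z → d ∣² compose z w
  ∣²-compose (x , y) (u , v) (d∣x , d∣y) =
    ∣m∣n⇒∣m+n (∣m⇒∣m*n u d∣x) (∣n⇒∣m*n c (∣m⇒∣m*n v d∣y)) ,
    ∣m∣n⇒∣m-n (∣m⇒∣m*n v d∣x) (∣m⇒∣m*n u d∣y)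

  fst-compose-square : ∀ z w → proj₁ (compose z w) * proj₁ (compose z w)
                             ≡ norm z * norm w - c * (proj₂ (compose z w) * proj₂ (compose z w))
  fst-compose-square (x , y) (u , v) = identity c x y u v
    where
    identity : ∀ c x y u v → (x * u + c * (y * v)) * (x * u + c * (y * v))
                           ≡ (x * x + c * (y * y)) * (u * u + c * (v * v)) - c * ((x * v - y * u) * (x * v - y * u))
    identity = solve-∀

  snd-compose*snd-compose-conj : ∀ z w → proj₂ (compose z w) * proj₂ (compose (conj z) w)
                                       ≡ proj₂ w * proj₂ w * norm z - proj₂ z * proj₂ z * norm w
  snd-compose*snd-compose-conj (x , y) (u , v) = identity c x y u v
    where
    identity : ∀ c x y u v → (x * v - y * u) * (x * v - - y * u) ≡ v * v * (x * x + c * (y * y)) - y * y * (u * u + c * (v * v))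
    identity = solve-∀

  snd-compose+snd-compose-conj : ∀ z w → proj₂ (compose z w) + proj₂ (compose (conj z) w) ≡ + 2 * (proj₁ z * proj₂ w)
  snd-compose+snd-compose-conj (x , y) (u , v) = identity x y u v
    where
    identity : ∀ x y u v → (x * v - y * u) + (x * v - - y * u) ≡ + 2 * (x * v)
    identity = solve-∀

  snd-compose-conj-snd-compose : ∀ z w → proj₂ (compose (conj z) w) - proj₂ (compose z w) ≡ + 2 * (proj₂ z * proj₁ w)
  snd-compose-conj-snd-compose (x , y) (u , v) = identity x y u v
    where
    identity : ∀ x y u v → (x * v - - y * u) - (x * v - y * u) ≡ + 2 * (y * u)
    identity = solve-∀

i*i≡+∣i∣*∣i∣ : ∀ i → i * i ≡ + (∣ i ∣ ℕ.* ∣ i ∣)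
i*i≡+∣i∣*∣i∣ (+ n) = sym (ℤ.pos-* n n)
i*i≡+∣i∣*∣i∣ -[1+ n ] = refl

n≤n*n : ∀ n → n ≤ n ℕ.* n
n≤n*n zero = z≤n
n≤n*n (suc n) = ℕ.m≤m*n (suc n) (suc n)

module _ (c : ℕ) .{{_ : NonZero c}} where

  open Form (+ c)

  norm-coordinates-bounded : ∀ {N} x y → norm (x , y) ≡ + N → ∣ x ∣ ≤ N × ∣ y ∣ ≤ N
  norm-coordinates-bounded {N} x y eq =
    ℕ.≤-trans (n≤n*n ∣ x ∣) (subst (x² ≤_) x²+cy²≡N (ℕ.m≤m+n x² (c ℕ.* y²))) ,
    ℕ.≤-trans (n≤n*n ∣ y ∣)
      (ℕ.≤-trans (ℕ.m≤n*m y² c) (subst (c ℕ.* y² ≤_) x²+cy²≡N (ℕ.m≤n+m (c ℕ.* y²) x²)))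
    where
    x² = ∣ x ∣ ℕ.* ∣ x ∣
    y² = ∣ y ∣ ℕ.* ∣ y ∣
    x²+cy²≡N : x² ℕ.+ c ℕ.* y² ≡ N
    x²+cy²≡N = ℤ.+-injective (begin
      + (x² ℕ.+ c ℕ.* y²)  ≡⟨ ℤ.pos-+ x² (c ℕ.* y²) ⟩
      + x² + + (c ℕ.* y²)  ≡⟨ cong (λ t → + x² + t) (ℤ.pos-* c y²) ⟩
      + x² + + c * + y²    ≡⟨ cong₂ (λ s t → s + + c * t) (i*i≡+∣i∣*∣i∣ x) (i*i≡+∣i∣*∣i∣ y) ⟨
      norm (x , y)         ≡⟨ eq ⟩
      + N                  ∎)
      where open ≡-Reasoning

  Reps-finite : ∀ N → Finite (Reps N)
  Reps-finite N = Finite-resp-↔ Σ-assoc-alt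
    (Σℤ-bounded-finite N _ (λ { x (y , (eq , _)) → proj₁ (norm-coordinates-bounded x y eq) })
      (λ x → Σℤ-bounded-finite N _ (λ y (eq , _) → proj₂ (norm-coordinates-bounded x y eq))
        (λ y → dec-irrelevant-finite ((_ ℤ.≟ _) ×-dec (_ ℤ.≟ _)) (IsRep-irrelevant (x , y)))))

-- j⊥snd-compose is what makes the quotients (z ∘ w) / p primitive.
module Correspondence
  (c : ℤ) {p m j : ℕ} (p-prime : Prime p) (p∤2 : ¬ p ℕ.∣ 2) (p∤c : ¬ p ℕ.∣ ∣ c ∣) (p⊥m : ℕ.Coprime p m)
  .{{_ : NonZero j}} (w : ℤ × ℤ) (w-rep : Form.IsRep c (j ℕ.* p) w)
  (j∣²compose : ∀ q → Form.IsRep c (j ℕ.* m) q → + j ∣² Form.compose c q w)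
  (j⊥snd-compose : ∀ z → Form.IsRep c (p ℕ.* m) z → Coprime (+ j) (proj₂ (Form.compose c z w)))
  where

  open Form c

  instance
    p≢0 : NonZero p
    p≢0 = prime⇒nonZero p-prime

  p≢1 : p ≢ 1
  p≢1 = nonTrivial⇒≢1 {{prime⇒nonTrivial p-prime}}

  u v : ℤ
  u = proj₁ w
  v = proj₂ w

  Sols : ℕ → Set
  Sols d = Σ (ℤ × ℤ) λ z → IsRep (d ℕ.* m) z × + d ∣² compose z w

  Sols-irrelevant : ∀ d .{{_ : NonZero d}} z → Irrelevant (IsRep (d ℕ.* m) z × + d ∣² compose z w)
  Sols-irrelevant d z (r , h) (r′ , h′) = cong₂ _,_ (IsRep-irrelevant z r r′) (∣²-irrelevant (compose z w) h h′)

  compose-quotient : ∀ {d e} z q .{{_ : NonZero d}} → d ℕ.* e ≡ j ℕ.* p →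
                     compose z w ≡ + d ·² q → compose q w ≡ + e ·² z
  compose-quotient {d} {e} z q de≡jp z∘w≡dq = ·²-cancel (+ d) (begin
    + d ·² compose q w     ≡⟨ compose-·²ˡ (+ d) q w ⟨
    compose (+ d ·² q) w   ≡⟨ cong (λ t → compose t w) z∘w≡dq ⟨
    compose (compose z w) w ≡⟨ compose-compose z w ⟩
    norm w ·² z            ≡⟨ cong (_·² z) (trans (proj₁ w-rep) (cong +_ (sym de≡jp))) ⟩
    + (d ℕ.* e) ·² z       ≡⟨ cong (_·² z) (ℤ.pos-* d e) ⟩
    (+ d * + e) ·² z       ≡⟨ ·²-assoc (+ d) (+ e) z ⟨
    + d ·² + e ·² z        ∎)
    where open ≡-Reasoning

  norm-quotient : ∀ {d e} z q .{{_ : NonZero d}} → d ℕ.* e ≡ j ℕ.* p → norm z ≡ + (d ℕ.* m) →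
                  compose z w ≡ + d ·² q → norm q ≡ + (e ℕ.* m)
  norm-quotient {d} {e} z q de≡jp nz z∘w≡dq = ℤ.*-cancelˡ-≡ (+ d) _ _ (ℤ.*-cancelˡ-≡ (+ d) _ _ (begin
    + d * (+ d * norm q)          ≡⟨ ℤ.*-assoc (+ d) (+ d) (norm q) ⟨
    + d * + d * norm q            ≡⟨ norm-·² (+ d) q ⟨
    norm (+ d ·² q)               ≡⟨ cong norm z∘w≡dq ⟨
    norm (compose z w)            ≡⟨ norm-compose z w ⟩
    norm z * norm w               ≡⟨ cong₂ _*_ nz (trans (proj₁ w-rep) (cong +_ (sym de≡jp))) ⟩
    + (d ℕ.* m) * + (d ℕ.* e)     ≡⟨ cong₂ _*_ (ℤ.pos-* d m) (ℤ.pos-* d e) ⟩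
    + d * + m * (+ d * + e)       ≡⟨ identity (+ d) (+ e) (+ m) ⟩
    + d * (+ d * (+ e * + m))     ≡⟨ cong (λ t → + d * (+ d * t)) (ℤ.pos-* e m) ⟨
    + d * (+ d * + (e ℕ.* m))     ∎))
    where
    open ≡-Reasoning
    identity : ∀ d e m → d * m * (d * e) ≡ d * (d * (e * m))
    identity = solve-∀

  common-divisor-∣-scale : ∀ {e g} z q → Primitive z → compose q w ≡ e ·² z → g ∣² q → g ∣ e
  common-divisor-∣-scale {g = g} z q prim q∘w≡ez g∣²q =
    ∣²-·²-primitive⇒∣ z prim (subst (g ∣²_) q∘w≡ez (∣²-compose q w g∣²q))

  QuotientsPrimitive : (d : ℕ) → .{{NonZero d}} → Set
  QuotientsPrimitive d = ∀ z q → IsRep (d ℕ.* m) z → compose z w ≡ + d ·² q → Primitive q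

  Sols-quotient : ∀ d e .{{_ : NonZero d}} → d ℕ.* e ≡ j ℕ.* p → QuotientsPrimitive d → Sols d → Sols e
  Sols-quotient d e de≡jp prim (z , rep@(nz , _) , d∣²z∘w) =
    q , (norm-quotient z q de≡jp nz z∘w≡dq , prim z q rep z∘w≡dq) ,
    subst (+ e ∣²_) (sym (compose-quotient z q de≡jp z∘w≡dq)) (·²⇒∣² (+ e) z)
    where
    q = proj₁ (∣²⇒∃·² (compose z w) d∣²z∘w)
    z∘w≡dq = proj₂ (∣²⇒∃·² (compose z w) d∣²z∘w)

  Sols-quotient-inverse : ∀ d e .{{_ : NonZero d}} .{{_ : NonZero e}}
                          (de≡jp : d ℕ.* e ≡ j ℕ.* p) (ed≡jp : e ℕ.* d ≡ j ℕ.* p)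
                          (prim-d : QuotientsPrimitive d) (prim-e : QuotientsPrimitive e) →
                          ∀ s → Sols-quotient e d ed≡jp prim-e (Sols-quotient d e de≡jp prim-d s) ≡ s
  Sols-quotient-inverse d e de≡jp ed≡jp prim-d prim-e s@(z , _ , d∣²z∘w) =
    Σ-≡-irrelevant (Sols-irrelevant d) (·²-cancel (+ e) (begin
      + e ·² z′        ≡⟨ proj₂ (∣²⇒∃·² (compose q w) e∣²q∘w) ⟨
      compose q w      ≡⟨ compose-quotient z q de≡jp (proj₂ (∣²⇒∃·² (compose z w) d∣²z∘w)) ⟩
      + e ·² z         ∎))
    where
    open ≡-Reasoning
    q = proj₁ (Sols-quotient d e de≡jp prim-d s)
    e∣²q∘w = proj₂ (proj₂ (Sols-quotient d e de≡jp prim-d s))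
    z′ = proj₁ (∣²⇒∃·² (compose q w) e∣²q∘w)

  p∣+p*n : ∀ {n} → + p ∣ + (p ℕ.* n)
  p∣+p*n {n} = divides (+ n) (trans (ℤ.pos-* p n) (ℤ.*-comm (+ p) (+ n)))

  p∣norm-w : + p ∣ norm w
  p∣norm-w = subst (+ p ∣_) (sym (proj₁ w-rep)) (subst (λ t → + p ∣ + t) (ℕ.*-comm p j) p∣+p*n)

  primitive⇒p∤² : ∀ z → Primitive z → ¬ (+ p ∣² z)
  primitive⇒p∤² z prim p∣²z = p≢1 (primitive⇒∣²⇒∣∣≡1 z prim p∣²z)

  norm≡pm⇒p∤² : ∀ z → norm z ≡ + (p ℕ.* m) → ¬ (+ p ∣² z)
  norm≡pm⇒p∤² z nz p∣²z = p≢1 (p⊥m (ℕ.∣-refl , ∣⇒∣ᵤ p∣m))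
    where
    open ≡-Reasoning
    r = proj₁ (∣²⇒∃·² z p∣²z)
    p*norm-r≡m : + p * norm r ≡ + m
    p*norm-r≡m = ℤ.*-cancelˡ-≡ (+ p) _ _ (begin
      + p * (+ p * norm r)  ≡⟨ ℤ.*-assoc (+ p) (+ p) (norm r) ⟨
      + p * + p * norm r    ≡⟨ norm-·² (+ p) r ⟨
      norm (+ p ·² r)       ≡⟨ cong norm (proj₂ (∣²⇒∃·² z p∣²z)) ⟨
      norm z                ≡⟨ nz ⟩
      + (p ℕ.* m)           ≡⟨ ℤ.pos-* p m ⟩
      + p * + m             ∎)
    p∣m : + p ∣ + m
    p∣m = divides (norm r) (trans (sym p*norm-r≡m) (ℤ.*-comm (+ p) (norm r)))

  p∣-cancel-∤ʳ : ∀ a b → + p ∣ a * b → ¬ (+ p ∣ b) → + p ∣ a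
  p∣-cancel-∤ʳ a b p∣ab p∤b with prime-∣-* p-prime a b p∣ab
  ... | inj₁ p∣a = p∣a
  ... | inj₂ p∣b = ⊥-elim (p∤b p∣b)

  p∣2*⇒p∣ : ∀ t → + p ∣ + 2 * t → + p ∣ t
  p∣2*⇒p∣ t p∣2t with prime-∣-* p-prime (+ 2) t p∣2t
  ... | inj₁ p∣2 = ⊥-elim (p∤2 (∣⇒∣ᵤ p∣2))
  ... | inj₂ p∣t = p∣t

  p∤v : ¬ (+ p ∣ v)
  p∤v p∣v = primitive⇒p∤² w (proj₂ w-rep) (p∣u , p∣v)
    where
    identity : ∀ c u v → u * u ≡ (u * u + c * (v * v)) - c * (v * v)
    identity = solve-∀
    p∣u = prime-∣-square p-prime u
      (subst (+ p ∣_) (sym (identity c u v)) (∣m∣n⇒∣m-n p∣norm-w (∣n⇒∣m*n c (∣n⇒∣m*n v p∣v))))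

  p∤u : ¬ (+ p ∣ u)
  p∤u p∣u = primitive⇒p∤² w (proj₂ w-rep) (p∣u , p∣v)
    where
    identity : ∀ c u v → (u * u + c * (v * v)) - u * u ≡ v * v * c
    identity = solve-∀
    p∣vv*c = subst (+ p ∣_) (identity c u v) (∣m∣n⇒∣m-n p∣norm-w (∣n⇒∣m*n u p∣u))
    p∣v = prime-∣-square p-prime v (p∣-cancel-∤ʳ (v * v) c p∣vv*c (p∤c ∘ ∣⇒∣ᵤ))

  p∣snd⇒p∣²compose : ∀ z → + p ∣ proj₂ (compose z w) → + p ∣² compose z w
  p∣snd⇒p∣²compose z p∣b = prime-∣-square p-prime _
    (subst (+ p ∣_) (sym (fst-compose-square z w))
      (∣m∣n⇒∣m-n (∣n⇒∣m*n (norm z) p∣norm-w) (∣n⇒∣m*n c (∣m⇒∣m*n (proj₂ (compose z w)) p∣b)))) , p∣b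

  p∣snd-compose-or-conj : ∀ z → IsRep (p ℕ.* m) z → ¬ (+ p ∣ proj₂ (compose z w)) → + p ∣ proj₂ (compose (conj z) w)
  p∣snd-compose-or-conj z (nz , _) p∤b = [ ⊥-elim ∘ p∤b , id ]′ (prime-∣-* p-prime _ _ p∣product)
    where
    p∣norm-z : + p ∣ norm z
    p∣norm-z = subst (+ p ∣_) (sym nz) p∣+p*n
    p∣product : + p ∣ proj₂ (compose z w) * proj₂ (compose (conj z) w)
    p∣product = subst (+ p ∣_) (sym (snd-compose*snd-compose-conj z w))
      (∣m∣n⇒∣m-n (∣n⇒∣m*n (v * v) p∣norm-z) (∣n⇒∣m*n (proj₂ z * proj₂ z) p∣norm-w))

  ¬p∣snd-compose-and-conj : ∀ z → IsRep (p ℕ.* m) z → + p ∣ proj₂ (compose z w) → ¬ (+ p ∣ proj₂ (compose (conj z) w))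
  ¬p∣snd-compose-and-conj z (_ , prim) p∣b p∣b′ = primitive⇒p∤² z prim (p∣x , p∣y)
    where
    p∣x = p∣-cancel-∤ʳ (proj₁ z) v
      (p∣2*⇒p∣ _ (subst (+ p ∣_) (snd-compose+snd-compose-conj z w) (∣m∣n⇒∣m+n p∣b p∣b′))) p∤v
    p∣y = p∣-cancel-∤ʳ (proj₂ z) u
      (p∣2*⇒p∣ _ (subst (+ p ∣_) (snd-compose-conj-snd-compose z w) (∣m∣n⇒∣m-n p∣b′ p∣b))) p∤u

  Reps-pm↔Sols-p⊎Sols-p : Reps (p ℕ.* m) ↔ (Sols p ⊎ Sols p)
  Reps-pm↔Sols-p⊎Sols-p = mk↔ₛ′ to from to-from from-to
    where
    split : ∀ z → IsRep (p ℕ.* m) z → Dec (+ p ∣ proj₂ (compose z w)) → Sols p ⊎ Sols p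
    split z rep (yes p∣b) = inj₁ (z , rep , p∣snd⇒p∣²compose z p∣b)
    split z rep (no p∤b) = inj₂ (conj z , conj-isRep z rep , p∣snd⇒p∣²compose (conj z) (p∣snd-compose-or-conj z rep p∤b))

    to : Reps (p ℕ.* m) → Sols p ⊎ Sols p
    to (z , rep) = split z rep (+ p ∣? proj₂ (compose z w))

    from : Sols p ⊎ Sols p → Reps (p ℕ.* m)
    from (inj₁ (z , rep , _)) = z , rep
    from (inj₂ (z , rep , _)) = conj z , conj-isRep z rep

    to-from : ∀ t → to (from t) ≡ t
    to-from (inj₁ (z , rep , p∣²)) with + p ∣? proj₂ (compose z w)
    ... | yes _ = cong inj₁ (Σ-≡-irrelevant (Sols-irrelevant p) refl)
    ... | no p∤b = ⊥-elim (p∤b (proj₂ p∣²))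
    to-from (inj₂ (z , rep , p∣²)) with + p ∣? proj₂ (compose (conj z) w)
    ... | yes p∣b′ = ⊥-elim (¬p∣snd-compose-and-conj z rep (proj₂ p∣²) p∣b′)
    ... | no _ = cong inj₂ (Σ-≡-irrelevant (Sols-irrelevant p) (conj-involutive z))

    from-split : ∀ z rep dec → from (split z rep dec) ≡ (z , rep)
    from-split z rep (yes _) = refl
    from-split z rep (no _) = Σ-≡-irrelevant IsRep-irrelevant (conj-involutive z)

    from-to : ∀ s → from (to s) ≡ s
    from-to (z , rep) = from-split z rep (+ p ∣? proj₂ (compose z w))

  quotients-by-p-primitive : QuotientsPrimitive p
  quotients-by-p-primitive z q rep@(_ , prim) z∘w≡pq =
    ∣²⇒∣∣≡1⇒primitive q λ g∣²q → j⊥snd-compose z rep (∣⇒∣ᵤ (g∣j g∣²q) , ∣⇒∣ᵤ (g∣snd g∣²q))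
    where
    g∣j : ∀ {g} → g ∣² q → g ∣ + j
    g∣j = common-divisor-∣-scale z q prim (compose-quotient {p} {j} z q (ℕ.*-comm p j) z∘w≡pq)
    g∣snd : ∀ {g} → g ∣² q → g ∣ proj₂ (compose z w)
    g∣snd {g} (_ , g∣b) = subst (g ∣_) (sym (cong proj₂ z∘w≡pq)) (∣n⇒∣m*n (+ p) g∣b)

  quotients-by-j-primitive : QuotientsPrimitive j
  quotients-by-j-primitive q z (nq , prim) q∘w≡jz =
    ∣²⇒∣∣≡1⇒primitive z λ g∣²z →
      [ id , (λ ∣g∣≡p → ⊥-elim (norm≡pm⇒p∤² z nz (p∣² ∣g∣≡p g∣²z))) ]′ (prime⇒irreducible p-prime (∣⇒∣ᵤ (g∣p g∣²z)))
    where
    nz = norm-quotient {j} {p} q z refl nq q∘w≡jz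
    g∣p : ∀ {g} → g ∣² z → g ∣ + p
    g∣p = common-divisor-∣-scale q z prim (compose-quotient {j} {p} q z refl q∘w≡jz)
    p∣² : ∀ {g} → ∣ g ∣ ≡ p → g ∣² z → + p ∣² z
    p∣² ∣g∣≡p (g∣x , g∣y) = ∣ᵤ⇒∣ (subst (ℕ._∣ _) ∣g∣≡p (∣⇒∣ᵤ g∣x)) , ∣ᵤ⇒∣ (subst (ℕ._∣ _) ∣g∣≡p (∣⇒∣ᵤ g∣y))

  Sols-p↔Sols-j : Sols p ↔ Sols j
  Sols-p↔Sols-j = mk↔ₛ′ (Sols-quotient p j (ℕ.*-comm p j) quotients-by-p-primitive)
                        (Sols-quotient j p refl quotients-by-j-primitive)
                        (Sols-quotient-inverse j p refl (ℕ.*-comm p j) quotients-by-j-primitive quotients-by-p-primitive)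
                        (Sols-quotient-inverse p j (ℕ.*-comm p j) refl quotients-by-p-primitive quotients-by-j-primitive)

  Sols-j↔Reps-jm : Sols j ↔ Reps (j ℕ.* m)
  Sols-j↔Reps-jm = mk↔ₛ′ (λ (q , rep , _) → q , rep) (λ (q , rep) → q , rep , j∣²compose q rep)
                         (λ _ → refl) (λ _ → Σ-≡-irrelevant (Sols-irrelevant j) refl)

  Reps-pm↔Reps-jm⊎Reps-jm : Reps (p ℕ.* m) ↔ (Reps (j ℕ.* m) ⊎ Reps (j ℕ.* m))
  Reps-pm↔Reps-jm⊎Reps-jm = ↔-trans Reps-pm↔Sols-p⊎Sols-p (Sols-p↔Reps-jm ⊎-↔ Sols-p↔Reps-jm)
    where
    Sols-p↔Reps-jm : Sols p ↔ Reps (j ℕ.* m)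
    Sols-p↔Reps-jm = ↔-trans Sols-p↔Sols-j Sols-j↔Reps-jm

-- Parity and residues modulo 8

Even Odd : ℤ → Set
Even z = ∃ λ k → z ≡ + 2 * k
Odd z = ∃ λ k → z ≡ + 2 * k + 1ℤ

even⇒2∣ : ∀ {z} → Even z → + 2 ∣ z
even⇒2∣ (k , z≡2k) = divides k (trans z≡2k (ℤ.*-comm (+ 2) k))

even-or-odd : ∀ z → Even z ⊎ Odd z
even-or-odd z with z %ℕ 2 | n%ℕd<d z 2 | a≡a%ℕn+[a/ℕn]*n z 2
... | 0 | _ | z≡2q = inj₁ (z /ℕ 2 , trans z≡2q (identity (z /ℕ 2)))
  where
  identity : ∀ q → + 0 + q * + 2 ≡ + 2 * q
  identity = solve-∀
... | 1 | _ | z≡2q+1 = inj₂ (z /ℕ 2 , trans z≡2q+1 (identity (z /ℕ 2)))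
  where
  identity : ∀ q → + 1 + q * + 2 ≡ + 2 * q + 1ℤ
  identity = solve-∀
... | suc (suc _) | s≤s (s≤s ()) | _

¬even∧odd : ∀ {z} → Even z → Odd z → ⊥
¬even∧odd even-z (l , z≡2l+1) = from-no (2 ℕ.∣? 1) (∣⇒∣ᵤ 2∣1)
  where
  2∣1 : + 2 ∣ 1ℤ
  2∣1 = ∣m+n∣m⇒∣n (subst (+ 2 ∣_) z≡2l+1 (even⇒2∣ even-z)) (even⇒2∣ (l , refl))

odd-* : ∀ {a b} → Odd a → Odd b → Odd (a * b)
odd-* (k , refl) (l , refl) = + 2 * k * l + k + l , identity k l
  where
  identity : ∀ k l → (+ 2 * k + 1ℤ) * (+ 2 * l + 1ℤ) ≡ + 2 * (+ 2 * k * l + k + l) + 1ℤ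
  identity = solve-∀

even-*ʳ : ∀ a {b} → Even b → Even (a * b)
even-*ʳ a (l , refl) = a * l , identity a l
  where
  identity : ∀ a l → a * (+ 2 * l) ≡ + 2 * (a * l)
  identity = solve-∀

odd-*⇒odd : ∀ a b → Odd (a * b) → Odd a × Odd b
odd-*⇒odd a b odd-ab with even-or-odd a | even-or-odd b
... | inj₂ odd-a | inj₂ odd-b = odd-a , odd-b
... | inj₁ even-a | _ = ⊥-elim (¬even∧odd (subst Even (ℤ.*-comm b a) (even-*ʳ b even-a)) odd-ab)
... | _ | inj₁ even-b = ⊥-elim (¬even∧odd (even-*ʳ a even-b) odd-ab)

odd-odd⇒even : ∀ {a b} → Odd a → Odd b → Even (a - b)
odd-odd⇒even (k , refl) (l , refl) = k - l , identity k l
  where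
  identity : ∀ k l → + 2 * k + 1ℤ - (+ 2 * l + 1ℤ) ≡ + 2 * (k - l)
  identity = solve-∀

odd-even⇒odd : ∀ {a b} → Odd a → Even b → Odd (a - b)
odd-even⇒odd (k , refl) (l , refl) = k - l , identity k l
  where
  identity : ∀ k l → + 2 * k + 1ℤ - + 2 * l ≡ + 2 * (k - l) + 1ℤ
  identity = solve-∀

odd-square : ∀ {z} → Odd z → ∃ λ k → z * z ≡ + 8 * k + 1ℤ
odd-square (l , refl) with even-or-odd l
... | inj₁ (t , refl) = + 2 * (t * t) + t , identity t
  where
  identity : ∀ t → (+ 2 * (+ 2 * t) + 1ℤ) * (+ 2 * (+ 2 * t) + 1ℤ) ≡ + 8 * (+ 2 * (t * t) + t) + 1ℤ
  identity = solve-∀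
... | inj₂ (t , refl) = + 2 * (t * t) + + 3 * t + 1ℤ , identity t
  where
  identity : ∀ t → (+ 2 * (+ 2 * t + 1ℤ) + 1ℤ) * (+ 2 * (+ 2 * t + 1ℤ) + 1ℤ) ≡ + 8 * (+ 2 * (t * t) + + 3 * t + 1ℤ) + 1ℤ
  identity = solve-∀

square+2*-even⇒even : ∀ x t → Even (x * x + + 2 * t) → Even x
square+2*-even⇒even x t even-n with even-or-odd x
... | inj₁ even-x = even-x
... | inj₂ (k , refl) = ⊥-elim (¬even∧odd even-n (+ 2 * (k * k) + + 2 * k + t , identity k t))
  where
  identity : ∀ k t → (+ 2 * k + 1ℤ) * (+ 2 * k + 1ℤ) + + 2 * t ≡ + 2 * (+ 2 * (k * k) + + 2 * k + t) + 1ℤ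
  identity = solve-∀

square+2*-odd⇒odd : ∀ x t → Odd (x * x + + 2 * t) → Odd x
square+2*-odd⇒odd x t odd-n with even-or-odd x
... | inj₂ odd-x = odd-x
... | inj₁ (k , refl) = ⊥-elim (¬even∧odd (+ 2 * (k * k) + t , identity k t) odd-n)
  where
  identity : ∀ k t → + 2 * k * (+ 2 * k) + + 2 * t ≡ + 2 * (+ 2 * (k * k) + t)
  identity = solve-∀

odd⇒coprime-divisor-of-8 : ∀ {j b} → j ℕ.∣ 8 → Odd b → Coprime (+ j) b
odd⇒coprime-divisor-of-8 {j} {b} j∣8 odd-b {i} (i∣j , i∣b) = ℕ.∣1⇒≡1 (∣⇒∣ᵤ i∣1)
  where
  k = proj₁ (odd-square odd-b)
  bb≡8k+1 = proj₂ (odd-square odd-b)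
  i∣8 : + i ∣ + 8
  i∣8 = ∣ᵤ⇒∣ (ℕ.∣-trans i∣j j∣8)
  i∣1 : + i ∣ 1ℤ
  i∣1 = ∣m+n∣m⇒∣n (subst (+ i ∣_) bb≡8k+1 (∣m⇒∣m*n b (∣ᵤ⇒∣ {i = b} i∣b))) (∣m⇒∣m*n k i∣8)

-- The form x² + 216 y²

open Form (+ 216)

norm≡square+2* : ∀ x y → norm (x , y) ≡ x * x + + 2 * (+ 108 * (y * y))
norm≡square+2* = identity
  where
  identity : ∀ x y → x * x + + 216 * (y * y) ≡ x * x + + 2 * (+ 108 * (y * y))
  identity = solve-∀

odd-norm⇒odd : ∀ x y → Odd (norm (x , y)) → Odd x
odd-norm⇒odd x y odd-n = square+2*-odd⇒odd x (+ 108 * (y * y)) (subst Odd (norm≡square+2* x y) odd-n)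

primitive-even-fst⇒odd-snd : ∀ {x y} → Primitive (x , y) → Even x → Odd y
primitive-even-fst⇒odd-snd {x} {y} prim even-x with even-or-odd y
... | inj₂ odd-y = odd-y
... | inj₁ even-y =
  ⊥-elim (from-no (2 ℕ.≟ 1) (primitive⇒∣²⇒∣∣≡1 (x , y) prim (even⇒2∣ even-x , even⇒2∣ even-y)))

rep-of-4*-shape : ∀ x y K → norm (x , y) ≡ + 4 * K → Primitive (x , y) →
                  ∃ λ x′ → x ≡ + 2 * x′ × x′ * x′ + + 2 * (+ 27 * (y * y)) ≡ K × Odd y
rep-of-4*-shape x y K n≡4K prim =
  x′ , x≡2x′ , ℤ.*-cancelˡ-≡ (+ 4) (x′ * x′ + + 2 * (+ 27 * (y * y))) K 4n′≡4K , primitive-even-fst⇒odd-snd prim even-x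
  where
  open ≡-Reasoning
  even-x : Even x
  even-x = square+2*-even⇒even x (+ 108 * (y * y))
    (+ 2 * K , trans (sym (norm≡square+2* x y)) (trans n≡4K (ℤ.*-assoc (+ 2) (+ 2) K)))
  x′ = proj₁ even-x
  x≡2x′ = proj₂ even-x
  identity : ∀ x′ y → + 4 * (x′ * x′ + + 2 * (+ 27 * (y * y))) ≡ + 2 * x′ * (+ 2 * x′) + + 216 * (y * y)
  identity = solve-∀
  4n′≡4K : + 4 * (x′ * x′ + + 2 * (+ 27 * (y * y))) ≡ + 4 * K
  4n′≡4K = begin
    + 4 * (x′ * x′ + + 2 * (+ 27 * (y * y))) ≡⟨ identity x′ y ⟩
    norm (+ 2 * x′ , y)                      ≡⟨ cong (λ t → norm (t , y)) x≡2x′ ⟨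
    norm (x , y)                             ≡⟨ n≡4K ⟩
    + 4 * K                                  ∎

rep-of-4*odd-shape : ∀ x y N → norm (x , y) ≡ + (4 ℕ.* N) → Odd (+ N) → Primitive (x , y) →
                     ∃ λ x′ → x ≡ + 2 * x′ × Odd x′ × Odd y
rep-of-4*odd-shape x y N n≡4N odd-N prim =
  x′ , x≡2x′ , square+2*-odd⇒odd x′ (+ 27 * (y * y)) (subst Odd (sym n′≡N) odd-N) , odd-y
  where
  x′ = proj₁ (rep-of-4*-shape x y (+ N) (trans n≡4N (ℤ.pos-* 4 N)) prim)
  x≡2x′ = proj₁ (proj₂ (rep-of-4*-shape x y (+ N) (trans n≡4N (ℤ.pos-* 4 N)) prim))
  n′≡N = proj₁ (proj₂ (proj₂ (rep-of-4*-shape x y (+ N) (trans n≡4N (ℤ.pos-* 4 N)) prim)))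
  odd-y = proj₂ (proj₂ (proj₂ (rep-of-4*-shape x y (+ N) (trans n≡4N (ℤ.pos-* 4 N)) prim)))

rep-of-8*-shape : ∀ x y N → norm (x , y) ≡ + (8 ℕ.* N) → Primitive (x , y) →
                  ∃ λ β → x ≡ + 4 * β × Odd y × + N ≡ + 2 * (β * β) + + 27 * (y * y)
rep-of-8*-shape x y N n≡8N prim = β , x≡4β , odd-y , ℤ.*-cancelˡ-≡ (+ 2) (+ N) (+ 2 * (β * β) + + 27 * (y * y)) 2N≡
  where
  open ≡-Reasoning
  shape = rep-of-4*-shape x y (+ 2 * + N) (trans n≡8N (trans (ℤ.pos-* 8 N) (ℤ.*-assoc (+ 4) (+ 2) (+ N)))) prim
  x′ = proj₁ shape
  x≡2x′ = proj₁ (proj₂ shape)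
  n′≡2N = proj₁ (proj₂ (proj₂ shape))
  odd-y = proj₂ (proj₂ (proj₂ shape))
  even-x′ = square+2*-even⇒even x′ (+ 27 * (y * y)) (+ N , n′≡2N)
  β = proj₁ even-x′
  x′≡2β = proj₂ even-x′
  x≡4β = trans x≡2x′ (trans (cong (+ 2 *_) x′≡2β) (sym (ℤ.*-assoc (+ 2) (+ 2) β)))
  identity : ∀ β y → + 2 * β * (+ 2 * β) + + 2 * (+ 27 * (y * y)) ≡ + 2 * (+ 2 * (β * β) + + 27 * (y * y))
  identity = solve-∀
  2N≡ : + 2 * + N ≡ + 2 * (+ 2 * (β * β) + + 27 * (y * y))
  2N≡ = begin
    + 2 * + N                                   ≡⟨ n′≡2N ⟨
    x′ * x′ + + 2 * (+ 27 * (y * y))            ≡⟨ cong (λ t → t * t + + 2 * (+ 27 * (y * y))) x′≡2β ⟩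
    + 2 * β * (+ 2 * β) + + 2 * (+ 27 * (y * y)) ≡⟨ identity β y ⟩
    + 2 * (+ 2 * (β * β) + + 27 * (y * y))      ∎

odd-snd-compose : ∀ x y {u v} → Odd (norm (x , y)) → Even u → Odd v → Odd (proj₂ (compose (x , y) (u , v)))
odd-snd-compose x y odd-n even-u odd-v = odd-even⇒odd (odd-* (odd-norm⇒odd x y odd-n) odd-v) (even-*ʳ y even-u)

4∣²compose : ∀ {a b u v} → (∃ λ a′ → a ≡ + 2 * a′ × Odd a′ × Odd b) →
             (∃ λ u′ → u ≡ + 2 * u′ × Odd u′ × Odd v) →
             + 4 ∣² compose (a , b) (u , v)
4∣²compose {b = b} {v = v} (a′ , refl , odd-a′ , odd-b) (u′ , refl , odd-u′ , odd-v) =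
  divides (a′ * u′ + + 54 * (b * v)) (identity₁ a′ b u′ v) ,
  divides t (begin
    + 2 * a′ * v - b * (+ 2 * u′) ≡⟨ identity₂ a′ b u′ v ⟩
    + 2 * (a′ * v - b * u′)       ≡⟨ cong (+ 2 *_) a′v-bu′≡2t ⟩
    + 2 * (+ 2 * t)               ≡⟨ identity₃ t ⟩
    t * + 4                       ∎)
  where
  open ≡-Reasoning
  t = proj₁ (odd-odd⇒even (odd-* odd-a′ odd-v) (odd-* odd-b odd-u′))
  a′v-bu′≡2t = proj₂ (odd-odd⇒even (odd-* odd-a′ odd-v) (odd-* odd-b odd-u′))
  identity₁ : ∀ a′ b u′ v → + 2 * a′ * (+ 2 * u′) + + 216 * (b * v) ≡ (a′ * u′ + + 54 * (b * v)) * + 4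
  identity₁ = solve-∀
  identity₂ : ∀ a′ b u′ v → + 2 * a′ * v - b * (+ 2 * u′) ≡ + 2 * (a′ * v - b * u′)
  identity₂ = solve-∀
  identity₃ : ∀ t → + 2 * (+ 2 * t) ≡ t * + 4
  identity₃ = solve-∀

2β²+27v²-mod-8 : ∀ β {v} → Odd v → (Even β × ∃ λ k → + 2 * (β * β) + + 27 * (v * v) ≡ + 8 * k + + 3)
                                  ⊎ (Odd β × ∃ λ k → + 2 * (β * β) + + 27 * (v * v) ≡ + 8 * k + + 5)
2β²+27v²-mod-8 β odd-v with even-or-odd β | odd-square odd-v
... | inj₁ (t , refl) | k , vv≡8k+1 =
  inj₁ ((t , refl) , t * t + + 27 * k + + 3 , trans (cong (λ s → + 2 * (+ 2 * t * (+ 2 * t)) + + 27 * s) vv≡8k+1) (identity t k))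
  where
  identity : ∀ t k → + 2 * (+ 2 * t * (+ 2 * t)) + + 27 * (+ 8 * k + 1ℤ) ≡ + 8 * (t * t + + 27 * k + + 3) + + 3
  identity = solve-∀
... | inj₂ odd-β | k , vv≡8k+1 with odd-square odd-β
...   | l , ββ≡8l+1 =
  inj₂ (odd-β , + 2 * l + + 27 * k + + 3 , trans (cong₂ (λ s r → + 2 * s + + 27 * r) ββ≡8l+1 vv≡8k+1) (identity l k))
  where
  identity : ∀ l k → + 2 * (+ 8 * l + 1ℤ) + + 27 * (+ 8 * k + 1ℤ) ≡ + 8 * (+ 2 * l + + 27 * k + + 3) + + 5
  identity = solve-∀

3*5≢1-mod-8 : ∀ a b c → (+ 8 * a + + 3) * (+ 8 * b + + 5) ≢ + 8 * c + 1ℤ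
3*5≢1-mod-8 a b c eq = from-no (8 ℕ.∣? 14) (∣⇒∣ᵤ (divides (c - d) (begin
  + 14                                           ≡⟨ identity₁ a b ⟩
  (+ 8 * a + + 3) * (+ 8 * b + + 5) - (+ 8 * d + 1ℤ) ≡⟨ cong (_- (+ 8 * d + 1ℤ)) eq ⟩
  + 8 * c + 1ℤ - (+ 8 * d + 1ℤ)                 ≡⟨ identity₂ c d ⟩
  (c - d) * + 8                                  ∎)))
  where
  open ≡-Reasoning
  d = + 8 * a * b + + 5 * a + + 3 * b
  identity₁ : ∀ a b → + 14 ≡ (+ 8 * a + + 3) * (+ 8 * b + + 5) - (+ 8 * (+ 8 * a * b + + 5 * a + + 3 * b) + 1ℤ)
  identity₁ = solve-∀
  identity₂ : ∀ c d → + 8 * c + 1ℤ - (+ 8 * d + 1ℤ) ≡ (c - d) * + 8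
  identity₂ = solve-∀

same-parity : ∀ β γ {v b} → Odd v → Odd b →
              (∃ λ k → (+ 2 * (β * β) + + 27 * (v * v)) * (+ 2 * (γ * γ) + + 27 * (b * b)) ≡ + 8 * k + 1ℤ) →
              (Even β × Even γ) ⊎ (Odd β × Odd γ)
same-parity β γ odd-v odd-b (k , eq) with 2β²+27v²-mod-8 β odd-v | 2β²+27v²-mod-8 γ odd-b
... | inj₁ (even-β , _) | inj₁ (even-γ , _) = inj₁ (even-β , even-γ)
... | inj₂ (odd-β , _) | inj₂ (odd-γ , _) = inj₂ (odd-β , odd-γ)
... | inj₁ (_ , s , ≡8s+3) | inj₂ (_ , t , ≡8t+5) =
  ⊥-elim (3*5≢1-mod-8 s t k (trans (cong₂ _*_ (sym ≡8s+3) (sym ≡8t+5)) eq))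
... | inj₂ (_ , s , ≡8s+5) | inj₁ (_ , t , ≡8t+3) =
  ⊥-elim (3*5≢1-mod-8 t s k (trans (ℤ.*-comm (+ 8 * t + + 3) (+ 8 * s + + 5)) (trans (cong₂ _*_ (sym ≡8s+5) (sym ≡8t+3)) eq)))


8∣²compose : ∀ {a b u v M P} →
             (∃ λ γ → a ≡ + 4 * γ × Odd b × M ≡ + 2 * (γ * γ) + + 27 * (b * b)) →
             (∃ λ β → u ≡ + 4 * β × Odd v × P ≡ + 2 * (β * β) + + 27 * (v * v)) →
             (∃ λ k → P * M ≡ + 8 * k + 1ℤ) → + 8 ∣² compose (a , b) (u , v)
8∣²compose {b = b} {v = v} (γ , refl , odd-b , refl) (β , refl , odd-v , refl) PM≡8k+1 =
  divides (+ 2 * γ * β + + 27 * (b * v)) (identity₁ γ b β v) ,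
  divides t (begin
    + 4 * γ * v - b * (+ 4 * β) ≡⟨ identity₂ γ b β v ⟩
    + 4 * (γ * v - b * β)       ≡⟨ cong (+ 4 *_) γv-bβ≡2t ⟩
    + 4 * (+ 2 * t)             ≡⟨ identity₃ t ⟩
    t * + 8                     ∎)
  where
  open ≡-Reasoning
  even-γv-bβ : Even (γ * v - b * β)
  even-γv-bβ with same-parity β γ odd-v odd-b PM≡8k+1
  ... | inj₁ ((r , refl) , (s , refl)) = s * v - b * r , identity s v b r
    where
    identity : ∀ s v b r → + 2 * s * v - b * (+ 2 * r) ≡ + 2 * (s * v - b * r)
    identity = solve-∀
  ... | inj₂ (odd-β , odd-γ) = odd-odd⇒even (odd-* odd-γ odd-v) (odd-* odd-b odd-β)
  t = proj₁ even-γv-bβ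
  γv-bβ≡2t = proj₂ even-γv-bβ
  identity₁ : ∀ γ b β v → + 4 * γ * (+ 4 * β) + + 216 * (b * v) ≡ (+ 2 * γ * β + + 27 * (b * v)) * + 8
  identity₁ = solve-∀
  identity₂ : ∀ γ b β v → + 4 * γ * v - b * (+ 4 * β) ≡ + 4 * (γ * v - b * β)
  identity₂ = solve-∀
  identity₃ : ∀ t → + 4 * (+ 2 * t) ≡ t * + 8
  identity₃ = solve-∀

module _ {p m : ℕ} (p-prime : Prime p) (p⊥m : ℕ.Coprime p m) (pm%24≡1 : (p ℕ.* m) % 24 ≡ 1) where

  private
    q : ℤ
    q = + (p ℕ.* m) /ℕ 24

  pm≡24q+1 : + (p ℕ.* m) ≡ + 24 * q + 1ℤ
  pm≡24q+1 = trans (a≡a%ℕn+[a/ℕn]*n (+ (p ℕ.* m)) 24) (trans (cong (λ r → + r + q * + 24) pm%24≡1) (identity q))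
    where
    identity : ∀ q → + 1 + q * + 24 ≡ + 24 * q + 1ℤ
    identity = solve-∀

  odd-pm : Odd (+ (p ℕ.* m))
  odd-pm = + 12 * q , trans pm≡24q+1 (identity q)
    where
    identity : ∀ q → + 24 * q + 1ℤ ≡ + 2 * (+ 12 * q) + 1ℤ
    identity = solve-∀

  pm≡1-mod-8 : ∃ λ k → + p * + m ≡ + 8 * k + 1ℤ
  pm≡1-mod-8 = + 3 * q , trans (sym (ℤ.pos-* p m)) (trans pm≡24q+1 (identity q))
    where
    identity : ∀ q → + 24 * q + 1ℤ ≡ + 8 * (+ 3 * q) + 1ℤ
    identity = solve-∀

  odd-p : Odd (+ p)
  odd-p = proj₁ (odd-*⇒odd (+ p) (+ m) (subst Odd (ℤ.pos-* p m) odd-pm))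

  odd-m : Odd (+ m)
  odd-m = proj₂ (odd-*⇒odd (+ p) (+ m) (subst Odd (ℤ.pos-* p m) odd-pm))

  p∤24 : ¬ p ℕ.∣ 24
  p∤24 p∣24 = nonTrivial⇒≢1 {{prime⇒nonTrivial p-prime}} (ℕ.∣1⇒≡1 (∣⇒∣ᵤ p∣1))
    where
    p∣1 : + p ∣ 1ℤ
    p∣1 = ∣m+n∣m⇒∣n (subst (+ p ∣_) pm≡24q+1 (∣ᵤ⇒∣ (ℕ.∣m⇒∣m*n m ℕ.∣-refl)))
                    (∣m⇒∣m*n q (∣ᵤ⇒∣ {i = + 24} p∣24))

  p∤2 : ¬ p ℕ.∣ 2
  p∤2 p∣2 = p∤24 (ℕ.∣-trans p∣2 (ℕ.divides 12 refl))

  p∤216 : ¬ p ℕ.∣ 216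
  p∤216 p∣216 with euclidsLemma 24 9 p-prime p∣216
  ... | inj₁ p∣24 = p∤24 p∣24
  ... | inj₂ p∣9 with euclidsLemma 3 3 p-prime p∣9
  ...   | inj₁ p∣3 = p∤24 (ℕ.∣-trans p∣3 (ℕ.divides 8 refl))
  ...   | inj₂ p∣3 = p∤24 (ℕ.∣-trans p∣3 (ℕ.divides 8 refl))

  coprime-snd-compose : ∀ {j u v} → j ℕ.∣ 8 → Even u → Odd v →
                        ∀ z → IsRep (p ℕ.* m) z → Coprime (+ j) (proj₂ (compose z (u , v)))
  coprime-snd-compose j∣8 even-u odd-v (x , y) (nz , _) =
    odd⇒coprime-divisor-of-8 j∣8 (odd-snd-compose x y (subst Odd (sym nz) odd-pm) even-u odd-v)

  -- Reps N unfolds to PrimSols N, so X p m and A j m are instances of Reps.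
  X↔A⊎A : ∀ {j} → J j → ∀ w → IsRep (j ℕ.* p) w → X p m ↔ (A j m ⊎ A j m)
  X↔A⊎A (inj₁ refl) w w-rep =
    Correspondence.Reps-pm↔Reps-jm⊎Reps-jm (+ 216) p-prime p∤2 p∤216 p⊥m w w-rep
      (λ _ _ → ∣ᵤ⇒∣ (ℕ.1∣ _) , ∣ᵤ⇒∣ (ℕ.1∣ _))
      (λ _ _ (i∣1 , _) → ℕ.∣1⇒≡1 i∣1)
  X↔A⊎A (inj₂ (inj₁ refl)) w@(u , v) w-rep@(nw , prim-w) =
    Correspondence.Reps-pm↔Reps-jm⊎Reps-jm (+ 216) p-prime p∤2 p∤216 p⊥m w w-rep
      (λ (a , b) (nq , prim-q) → 4∣²compose (rep-of-4*odd-shape a b m nq odd-m prim-q) w-shape)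
      (coprime-snd-compose (ℕ.divides 2 refl) (u′ , u≡2u′) odd-v)
    where
    w-shape = rep-of-4*odd-shape u v p nw odd-p prim-w
    u′ = proj₁ w-shape
    u≡2u′ = proj₁ (proj₂ w-shape)
    odd-v = proj₂ (proj₂ (proj₂ w-shape))
  X↔A⊎A (inj₂ (inj₂ refl)) w@(u , v) w-rep@(nw , prim-w) =
    Correspondence.Reps-pm↔Reps-jm⊎Reps-jm (+ 216) p-prime p∤2 p∤216 p⊥m w w-rep
      (λ (a , b) (nq , prim-q) → 8∣²compose (rep-of-8*-shape a b m nq prim-q) w-shape pm≡1-mod-8)
      (coprime-snd-compose ℕ.∣-refl (+ 2 * β , trans u≡4β (ℤ.*-assoc (+ 2) (+ 2) β)) odd-v)
    where
    w-shape = rep-of-8*-shape u v p nw prim-w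
    β = proj₁ w-shape
    u≡4β = proj₁ (proj₂ w-shape)
    odd-v = proj₁ (proj₂ (proj₂ w-shape))

lemma2p7 : (p m j : ℕ) → InP p → m > 0 → ℕ.Coprime p m → (p ℕ.* m) % 24 ≡ 1 →
    J j → PrimSols (j ℕ.* p) →
    ∃ λ n → HasCard (X p m) (2 ℕ.* n) × HasCard (A j m) n
lemma2p7 p m j (p-prime , _) _ p⊥m pm%24≡1 j∈J (w , w-rep) = n , X↔2n , A↔n
  where
  n = proj₁ (Reps-finite 216 (j ℕ.* m))
  A↔n = proj₂ (Reps-finite 216 (j ℕ.* m))
  X↔2n : X p m ↔ Fin (2 ℕ.* n)
  X↔2n = subst (λ k → X p m ↔ Fin (n ℕ.+ k)) (sym (ℕ.+-identityʳ n))
    (↔-trans (X↔A⊎A p-prime p⊥m pm%24≡1 j∈J w w-rep) (↔-trans (A↔n ⊎-↔ A↔n) (↔-sym (+↔⊎ {n} {n}))))
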